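{- Let $\mathcal{F}$ be a family of finite lattices that is closed under vertical sum and contains the $2$-element chain. For $n \ge 1$ let $f(n)$ be the number of $n$-element lattices in $\mathcal{F}$, counted up to isomorphism. Let $N \ge 2$ be an integer constant and put $c = f(N)^{1/(N-1)}$. Then $f(n) \ge \Omega(c^n)$ as $n \to \infty$.
   Context: All lattices are finite, nonempty and unlabeled (counted up to isomorphism). For lattices $L$ and $U$, the vertical sum $L+U$ is the lattice obtained from the disjoint union of $L$ and $U$ by identifying the top element of $L$ with the bottom element of $U$, with all elements of $L$ below all elements of $U$. A family $\mathcal{F}$ is closed under vertical sum if $L,U\in\mathcal{F}$ implies $L+U\in\mathcal{F}$. -}

module Defs where

open import Level using (0ℓ) renaming (suc to lsuc)
open import Data.Nat using (ℕ; zero; suc; _<_)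
open import Data.Fin using (Fin)
open import Data.Sum using (_⊎_; inj₁; inj₂)
open import Data.Product using (Σ; ∃; _×_; _,_)
open import Data.Empty using (⊥)
open import Function.Bundles using (_↔_; Inverse)
open import Relation.Binary.Core using (Rel)
open import Relation.Binary.PropositionalEquality using (_≡_)
open import Relation.Binary.Lattice.Structures using (IsLattice)

record FinLattice : Set₁ where
  field
    size      : ℕ
    nonempty  : 0 < size
    _⊑_       : Rel (Fin size) 0ℓ
    _∨_       : Fin size → Fin size → Fin size
    _∧_       : Fin size → Fin size → Fin size
    isLattice : IsLattice _≡_ _⊑_ _∨_ _∧_

open FinLattice public

_≅_ : FinLattice → FinLattice → Set
L ≅ M = Σ (Fin (size L) ↔ Fin (size M)) λ φ →
  ∀ x y → (_⊑_ L x y → _⊑_ M (Inverse.to φ x) (Inverse.to φ y))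
        × (_⊑_ M (Inverse.to φ x) (Inverse.to φ y) → _⊑_ L x y)

-- The preorder on the disjoint union  L ⊎ U  underlying the vertical sum:
-- all of L below all of U, and additionally the bottom of U below the top
-- of L (so that top(L) and bottom(U) become identified).
VSumLeq : (L U : FinLattice) → Fin (size L) ⊎ Fin (size U) → Fin (size L) ⊎ Fin (size U) → Set
VSumLeq L U (inj₁ x) (inj₁ y) = _⊑_ L x y
VSumLeq L U (inj₁ x) (inj₂ u) = Fin 1
VSumLeq L U (inj₂ u) (inj₁ x) = (∀ v → _⊑_ U u v) × (∀ y → _⊑_ L y x)
VSumLeq L U (inj₂ u) (inj₂ v) = _⊑_ U u v

-- M is (isomorphic to) the vertical sum L + U: M is the quotient of the
-- disjoint union of L and U by identifying top(L) with bottom(U), with all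
-- of L below all of U. Concretely: a surjection ψ from L ⊎ U onto M that
-- preserves and reflects the above preorder (its kernel is then exactly the
-- identification of top(L) with bottom(U), by antisymmetry in M).
IsVerticalSum : FinLattice → FinLattice → FinLattice → Set
IsVerticalSum L U M =
  Σ (Fin (size L) ⊎ Fin (size U) → Fin (size M)) λ ψ →
    (∀ m → ∃ λ a → ψ a ≡ m)
    × (∀ a b → (VSumLeq L U a b → _⊑_ M (ψ a) (ψ b))
             × (_⊑_ M (ψ a) (ψ b) → VSumLeq L U a b))

-- A family of finite lattices (a predicate, required to be invariant under
-- isomorphism, so that it is really a family of isomorphism types).
IsoInvariant : (FinLattice → Set) → Set₁
IsoInvariant F = ∀ L M → L ≅ M → F L → F M

ClosedUnderVerticalSum : (FinLattice → Set) → Set₁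
ClosedUnderVerticalSum F = ∀ L U M → F L → F U → IsVerticalSum L U M → F M

Is2Chain : FinLattice → Set
Is2Chain L = (size L ≡ 2) × (∀ x y → _⊑_ L x y ⊎ _⊑_ L y x)

ContainsTwoChain : (FinLattice → Set) → Set₁
ContainsTwoChain F = Σ FinLattice λ L → F L × Is2Chain L

-- k pairwise non-isomorphic n-element members of F, listed by Ls.
-- (Hence f(n) ≥ k.)
DistinctMembers : (FinLattice → Set) → (n k : ℕ) → (Fin k → FinLattice) → Set
DistinctMembers F n k Ls =
  (∀ i → F (Ls i) × (size (Ls i) ≡ n))
  × (∀ i j → Ls i ≅ Ls j → i ≡ j)

-- f(n) = k : Ls lists k pairwise non-isomorphic n-element members of F and
-- every n-element member of F is isomorphic to one of them.
CountIs : (FinLattice → Set) → (n k : ℕ) → (Fin k → FinLattice) → Set₁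
CountIs F n k Ls =
  DistinctMembers F n k Ls
  × (∀ L → F L → size L ≡ n → ∃ λ i → L ≅ Ls i)

-- Write N = p + 2 and let B₁, …, B_k be the k pairwise non-isomorphic
-- N-element members of F.  Every B_x has a bottom; a vertical sum
-- R + B_x adds exactly N − 1 = p + 1 new elements on top of R.  For
-- n = 2 + r + q(p+1) with r ≤ p we put
--     M_w = C_r + B_{w 1} + ⋯ + B_{w q}        (w a word of length q over k)
-- where C_r is the (r+2)-element chain, itself a vertical sum of 2-chains.  The core fact is CANCELLATION: if
-- R + B ≅ R' + B' with |R| = |R'|, then R ≅ R' and B ≅ B' (an order
-- isomorphism must send the top of R to the top of R', by a counting
-- argument), so distinct words give non-isomorphic lattices and
-- f(n) ≥ k^q.  Finally k^n ≤ k^N · (k^q)^(N−1), i.e. f(n)^(N−1) ≥ k^n / k^N.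

module Submission where

open import Defs
open import Level using (0ℓ)
open import Data.Nat using (ℕ; zero; suc; _+_; _*_; _^_; _∸_; _≤_; s≤s; z≤n)
open import Data.Nat.Properties
  using (+-assoc; +-comm; +-identityʳ; *-identityʳ; module ≤-Reasoning; +-monoˡ-≤; ≤-pred; ≤-trans;
         ^-monoʳ-≤; ^-distribˡ-+-*; ^-*-assoc; m≤n+m; 1+n≰n)
open import Data.Nat.DivMod using (_/_; _%_; m≡m%n+[m/n]*n; m%n<n)
open import Data.Fin using (Fin; zero; suc; _≟_; punchOut; finToFun; funToFin; combine)
open import Data.Fin.Properties
  using (+↔⊎; suc-injective; punchOut-injective; injective⇒≤; funToFin-finToFin)
open import Data.Fin.Permutation using (transpose)
open import Data.Sum using (_⊎_; inj₁; inj₂)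
open import Data.Sum.Properties using (inj₁-injective; ≡-dec)
open import Data.Product using (Σ; ∃; _×_; _,_; proj₁; proj₂)
open import Data.Empty using (⊥; ⊥-elim)
open import Data.Unit using (⊤; tt)
open import Function using (_∘_; id)
open import Function.Bundles using (_↔_; Inverse; mk↔ₛ′)
open import Function.Properties.Inverse using (↔-sym; ↔-trans)
open import Relation.Binary.Core using (Rel)
open import Relation.Binary.PropositionalEquality
open import Relation.Binary.Lattice.Structures using (IsLattice)
open import Relation.Nullary using (¬_)
open import Relation.Nullary.Decidable using (decidable-stable)

record OrderIso {A B : Set} (_≤₁_ : Rel A 0ℓ) (_≤₂_ : Rel B 0ℓ) : Set where
  field
    bijection : A ↔ B
    monotone  : ∀ {x y} → x ≤₁ y → Inverse.to bijection x ≤₂ Inverse.to bijection y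
    reflects  : ∀ {x y} → Inverse.to bijection x ≤₂ Inverse.to bijection y → x ≤₁ y
  open Inverse bijection public using (to; from; strictlyInverseˡ; strictlyInverseʳ)

  injective : ∀ {x y} → to x ≡ to y → x ≡ y
  injective {x} {y} e = begin
    x             ≡⟨ strictlyInverseʳ x ⟨
    from (to x)   ≡⟨ cong from e ⟩
    from (to y)   ≡⟨ strictlyInverseʳ y ⟩
    y             ∎
    where open ≡-Reasoning

toLatticeIso : ∀ {L M} → OrderIso (_⊑_ L) (_⊑_ M) → L ≅ M
toLatticeIso Φ = bijection , λ _ _ → monotone , reflects
  where open OrderIso Φ

fromLatticeIso : ∀ {L M} → L ≅ M → OrderIso (_⊑_ L) (_⊑_ M)
fromLatticeIso (φ , mono) = record
  { bijection = φ ; monotone = proj₁ (mono _ _) ; reflects = proj₂ (mono _ _) }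

module _ {A B : Set} {_≤₁_ : Rel A 0ℓ} {_≤₂_ : Rel B 0ℓ} where

  iso-sym : OrderIso _≤₁_ _≤₂_ → OrderIso _≤₂_ _≤₁_
  iso-sym Φ = record
    { bijection = ↔-sym bijection
    ; monotone  = λ {x} {y} x≤y → reflects (subst₂ _≤₂_ (sym (strictlyInverseˡ x)) (sym (strictlyInverseˡ y)) x≤y)
    ; reflects  = λ {x} {y} fx≤fy → subst₂ _≤₂_ (strictlyInverseˡ x) (strictlyInverseˡ y) (monotone fx≤fy) }
    where open OrderIso Φ

  iso-trans : {C : Set} {_≤₃_ : Rel C 0ℓ} → OrderIso _≤₁_ _≤₂_ → OrderIso _≤₂_ _≤₃_ → OrderIso _≤₁_ _≤₃_
  iso-trans Φ Ψ = record
    { bijection = ↔-trans (OrderIso.bijection Φ) (OrderIso.bijection Ψ)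
    ; monotone  = OrderIso.monotone Ψ ∘ OrderIso.monotone Φ
    ; reflects  = OrderIso.reflects Φ ∘ OrderIso.reflects Ψ }

IsOrderEmbedding : {X S : Set} → Rel X 0ℓ → Rel S 0ℓ → (X → S) → Set
IsOrderEmbedding _≤X_ _≤S_ e = ∀ x y → (x ≤X y → e x ≤S e y) × (e x ≤S e y → x ≤X y)

restrictIso : {S S′ X X′ : Set} {_≤S_ : Rel S 0ℓ} {_≤S′_ : Rel S′ 0ℓ} {_≤X_ : Rel X 0ℓ} {_≤X′_ : Rel X′ 0ℓ}
  (Φ : OrderIso _≤S_ _≤S′_) (e : X → S) (e′ : X′ → S′) →
  (∀ {x y} → e x ≡ e y → x ≡ y) → (∀ {x y} → e′ x ≡ e′ y → x ≡ y) →
  IsOrderEmbedding _≤X_ _≤S_ e → IsOrderEmbedding _≤X′_ _≤S′_ e′ →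
  (f : X → X′) (g : X′ → X) →
  (∀ x → OrderIso.to Φ (e x) ≡ e′ (f x)) → (∀ x → OrderIso.from Φ (e′ x) ≡ e (g x)) →
  OrderIso _≤X_ _≤X′_
restrictIso {_≤S′_ = _≤S′_} Φ e e′ e-inj e′-inj e-emb e′-emb f g Φe Φ⁻e′ = record
  { bijection = mk↔ₛ′ f g f∘g g∘f
  ; monotone  = λ {x} {y} x≤y → proj₂ (e′-emb (f x) (f y))
                 (subst₂ _≤S′_ (Φe x) (Φe y) (monotone (proj₁ (e-emb x y) x≤y)))
  ; reflects  = λ {x} {y} fx≤fy → proj₂ (e-emb x y) (reflects
                 (subst₂ _≤S′_ (sym (Φe x)) (sym (Φe y)) (proj₁ (e′-emb (f x) (f y)) fx≤fy))) }
  where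
  open OrderIso Φ
  f∘g : ∀ x′ → f (g x′) ≡ x′
  f∘g x′ = e′-inj (trans (sym (Φe (g x′))) (trans (cong to (sym (Φ⁻e′ x′))) (strictlyInverseˡ (e′ x′))))
  g∘f : ∀ x → g (f x) ≡ x
  g∘f x = e-inj (trans (sym (Φ⁻e′ (f x))) (trans (cong from (sym (Φe x))) (strictlyInverseʳ (e x))))

record LatticeOn (A : Set) : Set₁ where
  field
    le        : Rel A 0ℓ
    join      : A → A → A
    meet      : A → A → A
    isLatticeOn : IsLattice _≡_ le join meet
open LatticeOn public

toFinLattice : ∀ {n} → LatticeOn (Fin (suc n)) → FinLattice
toFinLattice {n} L = record
  { size = suc n ; nonempty = s≤s z≤n ; _⊑_ = le L ; _∨_ = join L ; _∧_ = meet L ; isLattice = isLatticeOn L }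

fromFinLattice : (L : FinLattice) → LatticeOn (Fin (size L))
fromFinLattice L = record { le = _⊑_ L ; join = _∨_ L ; meet = _∧_ L ; isLatticeOn = isLattice L }

transport : {A B : Set} → LatticeOn A → A ↔ B → LatticeOn B
transport {A} {B} L φ = record
  { le = λ x y → le L (from x) (from y)
  ; join = λ x y → to (join L (from x) (from y))
  ; meet = λ x y → to (meet L (from x) (from y))
  ; isLatticeOn = record
    { isPartialOrder = record
      { isPreorder = record { isEquivalence = isEquivalence ; reflexive = λ { refl → L.refl } ; trans = L.trans }
      ; antisym = λ p q → trans (sym (strictlyInverseˡ _)) (trans (cong to (L.antisym p q)) (strictlyInverseˡ _)) }
    ; supremum = λ x y →
        back (le L (from x)) (L.x≤x∨y _ _) , back (le L (from y)) (L.y≤x∨y _ _)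
      , λ z p q → back (λ w → le L w (from z)) (L.∨-least p q)
    ; infimum = λ x y →
        back (λ w → le L w (from x)) (L.x∧y≤x _ _) , back (λ w → le L w (from y)) (L.x∧y≤y _ _)
      , λ z p q → back (le L (from z)) (L.∧-greatest p q) } }
  where
  module L = IsLattice (isLatticeOn L)
  open Inverse φ
  back : (P : A → Set) {a : A} → P a → P (from (to a))
  back P = subst P (sym (strictlyInverseʳ _))

transport-iso : {A B : Set} (L : LatticeOn A) (φ : A ↔ B) → OrderIso (le L) (le (transport L φ))
transport-iso L φ = record
  { bijection = φ
  ; monotone  = λ {x} {y} → subst₂ (le L) (sym (strictlyInverseʳ x)) (sym (strictlyInverseʳ y))
  ; reflects  = λ {x} {y} → subst₂ (le L) (strictlyInverseʳ x) (strictlyInverseʳ y) }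
  where open Inverse φ

module Bounds {A : Set} (L : LatticeOn A) where
  private module L = IsLattice (isLatticeOn L)

  bigJoin : ∀ n → (Fin (suc n) → A) → A
  bigJoin zero    f = f zero
  bigJoin (suc n) f = join L (f zero) (bigJoin n (f ∘ suc))

  bigJoin-upper : ∀ n f i → le L (f i) (bigJoin n f)
  bigJoin-upper zero    f zero    = L.refl
  bigJoin-upper (suc n) f zero    = L.x≤x∨y _ _
  bigJoin-upper (suc n) f (suc i) = L.trans (bigJoin-upper n (f ∘ suc) i) (L.y≤x∨y _ _)

  bigMeet : ∀ n → (Fin (suc n) → A) → A
  bigMeet zero    f = f zero
  bigMeet (suc n) f = meet L (f zero) (bigMeet n (f ∘ suc))

  bigMeet-lower : ∀ n f i → le L (bigMeet n f) (f i)
  bigMeet-lower zero    f zero    = L.refl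
  bigMeet-lower (suc n) f zero    = L.x∧y≤x _ _
  bigMeet-lower (suc n) f (suc i) = L.trans (L.x∧y≤y _ _) (bigMeet-lower n (f ∘ suc) i)

top : ∀ {n} → LatticeOn (Fin (suc n)) → Fin (suc n)
top {n} L = Bounds.bigJoin L n id

top-greatest : ∀ {n} (L : LatticeOn (Fin (suc n))) x → le L x (top L)
top-greatest {n} L = Bounds.bigJoin-upper L n id

bottom : ∀ {n} → LatticeOn (Fin (suc n)) → Fin (suc n)
bottom {n} L = Bounds.bigMeet L n id

bottom-least : ∀ {n} (L : LatticeOn (Fin (suc n))) x → le L (bottom L) x
bottom-least {n} L = Bounds.bigMeet-lower L n id

-- Blocks: lattices on Fin (suc c) whose bottom is the element zero.  In a
-- vertical sum R + B the block B contributes its c elements  suc u.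

record Block (c : ℕ) : Set₁ where
  field
    lattice     : LatticeOn (Fin (suc c))
    zero-bottom : ∀ x → le lattice zero x
open Block public

normalise : ∀ {c} (L : FinLattice) → size L ≡ suc c → Σ (Block c) λ B → OrderIso (_⊑_ L) (le (lattice B))
normalise {c} L refl =
  record { lattice = transport L′ τ ; zero-bottom = λ x → bottom-least L′ (Inverse.from τ x) } , transport-iso L′ τ
  where
  L′ : LatticeOn (Fin (suc c))
  L′ = fromFinLattice L
  τ : Fin (suc c) ↔ Fin (suc c)
  τ = transpose (bottom L′) zero

-- The vertical sum R + B, first on the carrier  Fin (suc a) ⊎ Fin c
-- (the elements of R, then the non-bottom elements of B), then
-- transported to Fin (suc (a + c)).

module VerticalSum {a c : ℕ} (R : LatticeOn (Fin (suc a))) (B : Block c) where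
  private
    module R = IsLattice (isLatticeOn R)
    module B = IsLattice (isLatticeOn (lattice B))
    _≤B_ : Rel (Fin (suc c)) 0ℓ
    _≤B_ = le (lattice B)
    _∨B_ _∧B_ : Fin (suc c) → Fin (suc c) → Fin (suc c)
    _∨B_ = join (lattice B)
    _∧B_ = meet (lattice B)

  Carrier : Set
  Carrier = Fin (suc a) ⊎ Fin c

  glue : Carrier
  glue = inj₁ (top R)

  fromBlock : Fin (suc c) → Carrier
  fromBlock zero    = glue
  fromBlock (suc u) = inj₂ u

  _≼_ : Carrier → Carrier → Set
  inj₁ x ≼ inj₁ y = le R x y
  inj₁ x ≼ inj₂ v = ⊤
  inj₂ u ≼ inj₁ y = ⊥
  inj₂ u ≼ inj₂ v = suc u ≤B suc v

  _⊔_ : Carrier → Carrier → Carrier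
  inj₁ x ⊔ inj₁ y = inj₁ (join R x y)
  inj₁ x ⊔ inj₂ v = inj₂ v
  inj₂ u ⊔ inj₁ y = inj₂ u
  inj₂ u ⊔ inj₂ v = fromBlock (suc u ∨B suc v)

  _⊓_ : Carrier → Carrier → Carrier
  inj₁ x ⊓ inj₁ y = inj₁ (meet R x y)
  inj₁ x ⊓ inj₂ v = inj₁ x
  inj₂ u ⊓ inj₁ y = inj₁ y
  inj₂ u ⊓ inj₂ v = fromBlock (suc u ∧B suc v)

  not-below-bottom : ∀ u → ¬ (suc u ≤B zero)
  not-below-bottom u p with B.antisym p (zero-bottom B (suc u))
  ... | ()

  fromBlock-order : IsOrderEmbedding _≤B_ _≼_ fromBlock
  fromBlock-order zero    zero    = (λ _ → R.refl) , λ _ → B.refl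
  fromBlock-order zero    (suc w) = (λ _ → tt) , λ _ → zero-bottom B _
  fromBlock-order (suc z) zero    = not-below-bottom z , λ ()
  fromBlock-order (suc z) (suc w) = id , id

  fromBlock-injective : ∀ {z w} → fromBlock z ≡ fromBlock w → z ≡ w
  fromBlock-injective {zero}  {zero}  e    = refl
  fromBlock-injective {suc z} {suc w} refl = refl

  inj₁≼fromBlock : ∀ x z → inj₁ x ≼ fromBlock z
  inj₁≼fromBlock x zero    = top-greatest R x
  inj₁≼fromBlock x (suc z) = tt

  glue-comparable : ∀ z → z ≼ glue ⊎ glue ≼ z
  glue-comparable (inj₁ x) = inj₁ (top-greatest R x)
  glue-comparable (inj₂ u) = inj₂ tt

  strictly-below-glue : ∀ z → z ≼ glue → z ≢ glue → Σ (Fin (suc a)) λ y → z ≡ inj₁ y × top R ≢ y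
  strictly-below-glue (inj₁ y) _ z≢glue = y , refl , λ t≡y → z≢glue (cong inj₁ (sym t≡y))

  ≼-trans : ∀ {x y z} → x ≼ y → y ≼ z → x ≼ z
  ≼-trans {inj₁ x} {inj₁ y} {inj₁ z} p q = R.trans p q
  ≼-trans {inj₁ x} {inj₁ y} {inj₂ z} p q = tt
  ≼-trans {inj₁ x} {inj₂ y} {inj₂ z} p q = tt
  ≼-trans {inj₂ x} {inj₂ y} {inj₂ z} p q = B.trans p q

  private
    below-inj₂ : ∀ z v → z ≤B suc v → fromBlock z ≼ inj₂ v
    below-inj₂ z v = proj₁ (fromBlock-order z (suc v))

    above-inj₂ : ∀ u z → suc u ≤B z → inj₂ u ≼ fromBlock z
    above-inj₂ u z = proj₁ (fromBlock-order (suc u) z)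

    refl≼ : ∀ {x y} → x ≡ y → x ≼ y
    refl≼ {inj₁ x} refl = R.refl
    refl≼ {inj₂ u} refl = B.refl

    antisym≼ : ∀ {x y} → x ≼ y → y ≼ x → x ≡ y
    antisym≼ {inj₁ x} {inj₁ y} p q = cong inj₁ (R.antisym p q)
    antisym≼ {inj₂ x} {inj₂ y} p q = cong inj₂ (suc-injective (B.antisym p q))

    supremum : ∀ x y → x ≼ (x ⊔ y) × y ≼ (x ⊔ y) × ∀ z → x ≼ z → y ≼ z → (x ⊔ y) ≼ z
    supremum (inj₁ x) (inj₁ y) = R.x≤x∨y x y , R.y≤x∨y x y , λ { (inj₁ z) p q → R.∨-least p q ; (inj₂ z) p q → tt }
    supremum (inj₁ x) (inj₂ v) = tt , B.refl , λ { (inj₁ z) p () ; (inj₂ z) p q → q }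
    supremum (inj₂ u) (inj₁ y) = B.refl , tt , λ { (inj₁ z) () q ; (inj₂ z) p q → p }
    supremum (inj₂ u) (inj₂ v) = above-inj₂ u _ (B.x≤x∨y _ _) , above-inj₂ v _ (B.y≤x∨y _ _)
      , λ { (inj₁ z) () q ; (inj₂ z) p q → below-inj₂ _ z (B.∨-least p q) }

    infimum : ∀ x y → (x ⊓ y) ≼ x × (x ⊓ y) ≼ y × ∀ z → z ≼ x → z ≼ y → z ≼ (x ⊓ y)
    infimum (inj₁ x) (inj₁ y) = R.x∧y≤x x y , R.x∧y≤y x y , λ { (inj₁ z) p q → R.∧-greatest p q ; (inj₂ z) () q }
    infimum (inj₁ x) (inj₂ v) = R.refl , tt , λ { (inj₁ z) p q → p ; (inj₂ z) () q }
    infimum (inj₂ u) (inj₁ y) = tt , R.refl , λ { (inj₁ z) p q → q ; (inj₂ z) p () }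
    infimum (inj₂ u) (inj₂ v) = below-inj₂ _ u (B.x∧y≤x _ _) , below-inj₂ _ v (B.x∧y≤y _ _)
      , λ { (inj₁ z) p q → inj₁≼fromBlock z (suc u ∧B suc v) ; (inj₂ z) p q → above-inj₂ z _ (B.∧-greatest p q) }

  sumOn : LatticeOn Carrier
  sumOn = record
    { le = _≼_ ; join = _⊔_ ; meet = _⊓_
    ; isLatticeOn = record
      { isPartialOrder = record
        { isPreorder = record
          { isEquivalence = isEquivalence
          ; reflexive = λ {x} {y} → refl≼ {x} {y}
          ; trans = λ {x} {y} {z} → ≼-trans {x} {y} {z} }
        ; antisym = antisym≼ }
      ; supremum = supremum ; infimum = infimum } }

  enumerate : Carrier ↔ Fin (suc (a + c))
  enumerate = ↔-sym +↔⊎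

  sum : LatticeOn (Fin (suc (a + c)))
  sum = transport sumOn enumerate

  isVerticalSum : IsVerticalSum (toFinLattice R) (toFinLattice (lattice B)) (toFinLattice sum)
  isVerticalSum = to ∘ embed , onto , λ p q →
      (λ v → subst₂ _≼_ (sym (strictlyInverseʳ (embed p))) (sym (strictlyInverseʳ (embed q))) (proj₁ (embed-order p q) v))
    , (λ w → proj₂ (embed-order p q) (subst₂ _≼_ (strictlyInverseʳ (embed p)) (strictlyInverseʳ (embed q)) w))
    where
    open Inverse enumerate
    embed : Fin (suc a) ⊎ Fin (suc c) → Carrier
    embed (inj₁ x) = inj₁ x
    embed (inj₂ u) = fromBlock u

    embed-order : ∀ p q → (VSumLeq (toFinLattice R) (toFinLattice (lattice B)) p q → embed p ≼ embed q)
                        × (embed p ≼ embed q → VSumLeq (toFinLattice R) (toFinLattice (lattice B)) p q)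
    embed-order (inj₁ x)       (inj₁ y)       = id , id
    embed-order (inj₁ x)       (inj₂ v)       = (λ _ → inj₁≼fromBlock x v) , λ _ → zero
    embed-order (inj₂ zero)    (inj₁ y)       = (λ b≤x → proj₂ b≤x (top R)) , λ t≤y → zero-bottom B , λ w → R.trans (top-greatest R w) t≤y
    embed-order (inj₂ (suc u)) (inj₁ y)       = (λ b≤x → not-below-bottom u (proj₁ b≤x zero)) , λ ()
    embed-order (inj₂ u)       (inj₂ v)       = fromBlock-order u v

    onto : ∀ m → ∃ λ p → to (embed p) ≡ m
    onto m with from m in eq
    ... | inj₁ x = inj₁ x       , trans (cong to (sym eq)) (strictlyInverseˡ m)
    ... | inj₂ u = inj₂ (suc u) , trans (cong to (sym eq)) (strictlyInverseˡ m)

_+ᵥ_ : ∀ {a c} → LatticeOn (Fin (suc a)) → Block c → LatticeOn (Fin (suc (a + c)))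
R +ᵥ B = VerticalSum.sum R B

module GlueMaps {a c₁ c₂ : ℕ} (R₁ : LatticeOn (Fin (suc a))) (B₁ : Block c₁)
                (R₂ : LatticeOn (Fin (suc a))) (B₂ : Block c₂)
                (Ψ : OrderIso (VerticalSum._≼_ R₁ B₁) (VerticalSum._≼_ R₂ B₂)) where
  private
    module S₁ = VerticalSum R₁ B₁
    module S₂ = VerticalSum R₂ B₂
    module R₁ = IsLattice (isLatticeOn R₁)
    open OrderIso Ψ renaming (to to ψ; monotone to ψ-mono; reflects to ψ-reflect)

  -- ψ cannot send the glued point strictly below the glued point: the a + 1
  -- elements of R₁ would land injectively among the a elements strictly
  -- below S₂.glue (a pigeonhole argument).
  not-strictly-below : ψ S₁.glue S₂.≼ S₂.glue → ¬ ¬ (ψ S₁.glue ≡ S₂.glue)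
  not-strictly-below p ne = 1+n≰n (injective⇒≤ code-injective)
    where
    -- if some element of R₁ hits S₂.glue, it is above ψ S₁.glue, hence the top
    glue-hit : ∀ x → ψ (inj₁ x) ≡ S₂.glue → ψ S₁.glue ≡ S₂.glue
    glue-hit x e = trans (cong (ψ ∘ inj₁) top≡x) e
      where
      top≡x : top R₁ ≡ x
      top≡x = R₁.antisym (ψ-reflect (subst (ψ S₁.glue S₂.≼_) (sym e) p)) (top-greatest R₁ x)

    image : ∀ x → Σ (Fin (suc a)) λ y → ψ (inj₁ x) ≡ inj₁ y × top R₂ ≢ y
    image x = S₂.strictly-below-glue (ψ (inj₁ x)) (S₂.≼-trans {ψ (inj₁ x)} {ψ S₁.glue} (ψ-mono {inj₁ x} {S₁.glue} (top-greatest R₁ x)) p) (ne ∘ glue-hit x)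

    code : Fin (suc a) → Fin a
    code x = punchOut (proj₂ (proj₂ (image x)))

    code-injective : ∀ {x x′} → code x ≡ code x′ → x ≡ x′
    code-injective {x} {x′} e = inj₁-injective (injective (begin
      ψ (inj₁ x)                 ≡⟨ proj₁ (proj₂ (image x)) ⟩
      inj₁ (proj₁ (image x))     ≡⟨ cong inj₁ (punchOut-injective (proj₂ (proj₂ (image x))) (proj₂ (proj₂ (image x′))) e) ⟩
      inj₁ (proj₁ (image x′))    ≡⟨ proj₁ (proj₂ (image x′)) ⟨
      ψ (inj₁ x′)                ∎))
      where open ≡-Reasoning

  module _ (ψ-glue : ψ S₁.glue ≡ S₂.glue) where

    onR : ∀ x → Σ (Fin (suc a)) λ y → ψ (inj₁ x) ≡ inj₁ y
    onR x with ψ (inj₁ x) | subst (ψ (inj₁ x) S₂.≼_) ψ-glue (ψ-mono {inj₁ x} {S₁.glue} (top-greatest R₁ x))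
    ... | inj₁ y | _ = y , refl

    private
      onB : ∀ u → Σ (Fin c₂) λ v → ψ (inj₂ u) ≡ inj₂ v
      onB u with ψ (inj₂ u) | ψ-reflect {inj₂ u} {S₁.glue}
      ... | inj₂ v | _           = v , refl
      ... | inj₁ w | not-below = ⊥-elim (not-below (subst (inj₁ w S₂.≼_) (sym ψ-glue) (top-greatest R₂ w)))

    blockMap : Fin (suc c₁) → Fin (suc c₂)
    blockMap zero    = zero
    blockMap (suc u) = suc (proj₁ (onB u))

    blockMap-commutes : ∀ z → ψ (S₁.fromBlock z) ≡ S₂.fromBlock (blockMap z)
    blockMap-commutes zero    = ψ-glue
    blockMap-commutes (suc u) = proj₂ (onB u)

-- The glued points correspond under any isomorphism of vertical sums: they
-- are comparable, and neither direction of the isomorphism can push one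
-- strictly below the other.
module _ {a c₁ c₂ : ℕ} (R₁ : LatticeOn (Fin (suc a))) (B₁ : Block c₁)
         (R₂ : LatticeOn (Fin (suc a))) (B₂ : Block c₂)
         (Ψ : OrderIso (VerticalSum._≼_ R₁ B₁) (VerticalSum._≼_ R₂ B₂)) where
  private
    module S₁ = VerticalSum R₁ B₁
    module S₂ = VerticalSum R₂ B₂
    open OrderIso Ψ

  glue-preserved : to S₁.glue ≡ S₂.glue
  glue-preserved with S₂.glue-comparable (to S₁.glue)
  ... | inj₁ below = decidable-stable (≡-dec _≟_ _≟_ _ _) (GlueMaps.not-strictly-below R₁ B₁ R₂ B₂ Ψ below)
  ... | inj₂ above = begin
      to S₁.glue          ≡⟨ cong to from-glue ⟨
      to (from S₂.glue)   ≡⟨ strictlyInverseˡ S₂.glue ⟩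
      S₂.glue             ∎
    where
    open ≡-Reasoning
    below : from S₂.glue S₁.≼ S₁.glue
    below = subst (from S₂.glue S₁.≼_) (strictlyInverseʳ S₁.glue)
      (OrderIso.monotone (iso-sym Ψ) {S₂.glue} {to S₁.glue} above)
    from-glue : from S₂.glue ≡ S₁.glue
    from-glue = decidable-stable (≡-dec _≟_ _≟_ _ _) (GlueMaps.not-strictly-below R₂ B₂ R₁ B₁ (iso-sym Ψ) below)

cancel : ∀ {a c₁ c₂} (R₁ R₂ : LatticeOn (Fin (suc a))) (B₁ : Block c₁) (B₂ : Block c₂) →
  OrderIso (le (R₁ +ᵥ B₁)) (le (R₂ +ᵥ B₂)) →
  OrderIso (le R₁) (le R₂) × OrderIso (le (lattice B₁)) (le (lattice B₂))
cancel R₁ R₂ B₁ B₂ I =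
    restrictIso Ψ inj₁ inj₁ inj₁-injective inj₁-injective (λ _ _ → id , id) (λ _ _ → id , id)
      (proj₁ ∘ G.onR glue₁↦glue₂) (proj₁ ∘ G⁻.onR glue₂↦glue₁) (proj₂ ∘ G.onR glue₁↦glue₂) (proj₂ ∘ G⁻.onR glue₂↦glue₁)
  , restrictIso Ψ S₁.fromBlock S₂.fromBlock S₁.fromBlock-injective S₂.fromBlock-injective S₁.fromBlock-order S₂.fromBlock-order
      (G.blockMap glue₁↦glue₂) (G⁻.blockMap glue₂↦glue₁) (G.blockMap-commutes glue₁↦glue₂) (G⁻.blockMap-commutes glue₂↦glue₁)
  where
  module S₁ = VerticalSum R₁ B₁
  module S₂ = VerticalSum R₂ B₂

  -- I, read on the carriers of the sums before enumeration
  Ψ : OrderIso S₁._≼_ S₂._≼_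
  Ψ = iso-trans (transport-iso S₁.sumOn S₁.enumerate) (iso-trans I (iso-sym (transport-iso S₂.sumOn S₂.enumerate)))
  module G  = GlueMaps R₁ B₁ R₂ B₂ Ψ
  module G⁻ = GlueMaps R₂ B₂ R₁ B₁ (iso-sym Ψ)

  glue₁↦glue₂ : OrderIso.to Ψ S₁.glue ≡ S₂.glue
  glue₁↦glue₂ = glue-preserved R₁ B₁ R₂ B₂ Ψ
  glue₂↦glue₁ : OrderIso.from Ψ S₂.glue ≡ S₁.glue
  glue₂↦glue₁ = glue-preserved R₂ B₂ R₁ B₁ (iso-sym Ψ)

height : ℕ → ℕ → ℕ → ℕ
height a c zero    = a
height a c (suc q) = height a c q + c

height-closed : ∀ a c q → height a c q ≡ a + q * c
height-closed a c zero    = sym (+-identityʳ a)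
height-closed a c (suc q) = begin
  height a c q + c   ≡⟨ cong (_+ c) (height-closed a c q) ⟩
  a + q * c + c      ≡⟨ +-assoc a (q * c) c ⟩
  a + (q * c + c)    ≡⟨ cong (a +_) (+-comm (q * c) c) ⟩
  a + (c + q * c)    ∎
  where open ≡-Reasoning

stack : ∀ {a c} → LatticeOn (Fin (suc a)) → (q : ℕ) → (Fin q → Block c) → LatticeOn (Fin (suc (height a c q)))
stack R zero    bs = R
stack R (suc q) bs = stack R q (bs ∘ suc) +ᵥ bs zero

stack-∈ : (F : FinLattice → Set) → ClosedUnderVerticalSum F →
  ∀ {a c} {R : LatticeOn (Fin (suc a))} q (bs : Fin q → Block c) →
  F (toFinLattice R) → (∀ i → F (toFinLattice (lattice (bs i)))) → F (toFinLattice (stack R q bs))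
stack-∈ F closed zero    bs R∈F bs∈F = R∈F
stack-∈ F closed (suc q) bs R∈F bs∈F =
  closed _ _ _ (stack-∈ F closed q (bs ∘ suc) R∈F (bs∈F ∘ suc)) (bs∈F zero) (VerticalSum.isVerticalSum _ _)

stack-cancel : ∀ {a c} (R : LatticeOn (Fin (suc a))) q (bs bs′ : Fin q → Block c) →
  OrderIso (le (stack R q bs)) (le (stack R q bs′)) → ∀ i → OrderIso (le (lattice (bs i))) (le (lattice (bs′ i)))
stack-cancel R (suc q) bs bs′ I zero    = proj₂ (cancel _ _ _ _ I)
stack-cancel R (suc q) bs bs′ I (suc i) = stack-cancel R q (bs ∘ suc) (bs′ ∘ suc) (proj₁ (cancel _ _ _ _ I)) i

-- Words of length q over k letters, coded by Fin (k ^ q).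

funToFin-cong : ∀ {m n} {f g : Fin m → Fin n} → f ≗ g → funToFin f ≡ funToFin g
funToFin-cong {zero}  f≗g = refl
funToFin-cong {suc m} f≗g = cong₂ combine (f≗g zero) (funToFin-cong (f≗g ∘ suc))

finToFun-injective : ∀ {k q} {i j : Fin (k ^ q)} → finToFun i ≗ finToFun j → i ≡ j
finToFun-injective {k} {q} {i} {j} e = begin
  i                                ≡⟨ funToFin-finToFin {q} {k} i ⟨
  funToFin (finToFun {k} {q} i)    ≡⟨ funToFin-cong {q} {k} e ⟩
  funToFin (finToFun {k} {q} j)    ≡⟨ funToFin-finToFin {q} {k} j ⟩
  j                                ∎
  where open ≡-Reasoning

BlockFor : (F : FinLattice → Set) → ℕ → FinLattice → Set₁
BlockFor F c L = Σ (Block c) λ B → F (toFinLattice (lattice B)) × OrderIso (_⊑_ L) (le (lattice B))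

asBlock : ∀ {c} (F : FinLattice → Set) → IsoInvariant F → (L : FinLattice) → F L → size L ≡ suc c → BlockFor F c L
asBlock F isoInv L L∈F L-size = B , isoInv _ _ (toLatticeIso {L} {toFinLattice (lattice B)} L≅B) L∈F , L≅B
  where
  B = proj₁ (normalise L L-size)
  L≅B = proj₂ (normalise L L-size)

module Stacks (F : FinLattice → Set) (closed : ClosedUnderVerticalSum F)
              (two : Block 1) (two∈F : F (toFinLattice (lattice two)))
              {k c : ℕ} (blocks : Fin k → Block c) (blocks∈F : ∀ x → F (toFinLattice (lattice (blocks x))))
              (blocks-distinct : ∀ x y → OrderIso (le (lattice (blocks x))) (le (lattice (blocks y))) → x ≡ y) where

  -- the (r + 2)-element chain
  chain : (r : ℕ) → LatticeOn (Fin (suc (height 1 1 r)))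
  chain r = stack (lattice two) r (λ _ → two)

  member : (r q : ℕ) → Fin (k ^ q) → FinLattice
  member r q i = toFinLattice (stack (chain r) q (blocks ∘ finToFun i))

  member-size : ∀ r q i → size (member r q i) ≡ 2 + (r + q * c)
  member-size r q i = begin
    suc (height (height 1 1 r) c q)  ≡⟨ cong suc (height-closed _ c q) ⟩
    suc (height 1 1 r + q * c)       ≡⟨ cong (λ h → suc (h + q * c)) (height-closed 1 1 r) ⟩
    2 + (r * 1 + q * c)              ≡⟨ cong (λ t → 2 + (t + q * c)) (*-identityʳ r) ⟩
    2 + (r + q * c)                  ∎
    where open ≡-Reasoning

  members : ∀ r q → DistinctMembers F (2 + (r + q * c)) (k ^ q) (member r q)
  members r q = (λ i → member-∈ i , member-size r q i) , λ i j i≅j →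
      finToFun-injective {k} {q} λ x → blocks-distinct _ _ (stack-cancel (chain r) q _ _ (fromLatticeIso {member r q i} {member r q j} i≅j) x)
    where
    member-∈ : ∀ i → F (member r q i)
    member-∈ i = stack-∈ F closed q _ (stack-∈ F closed r _ two∈F (λ _ → two∈F)) (blocks∈F ∘ finToFun {k} {q} i)

power-bound : ∀ k {n} e q s → suc n ≤ e + q * s → k ^ suc n ≤ k ^ e * (k ^ q) ^ s
power-bound zero    e q s _  = z≤n
power-bound (suc k) {n} e q s n≤ = begin
  suc k ^ suc n                 ≤⟨ ^-monoʳ-≤ (suc k) n≤ ⟩
  suc k ^ (e + q * s)           ≡⟨ ^-distribˡ-+-* (suc k) e (q * s) ⟩
  suc k ^ e * suc k ^ (q * s)   ≡⟨ cong (suc k ^ e *_) (^-*-assoc (suc k) q s) ⟨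
  suc k ^ e * (suc k ^ q) ^ s   ∎
  where open ≤-Reasoning

division : ∀ n p → n ≡ n % suc p + (n / suc p) * suc p
division n p = m≡m%n+[m/n]*n n (suc p)

quotient-bound : ∀ n p → n ≤ p + (n / suc p) * suc p
quotient-bound n p = subst (_≤ p + (n / suc p) * suc p) (sym (division n p))
  (+-monoˡ-≤ ((n / suc p) * suc p) (≤-pred (m%n<n n (suc p))))

-- The theorem.  With N = p + 2, d = k^N and n₀ = 2: for n = 2 + m write
-- m = r + q(p+1) with r ≤ p; the k^q stacks of size n give
-- k^n ≤ k^N · (k^q)^(N−1) ≤ (1 + d) · (k^q)^(N−1).

theorem2 : (F : FinLattice → Set) → IsoInvariant F → ClosedUnderVerticalSum F → ContainsTwoChain F →
    (N : ℕ) → 2 ≤ N → (k : ℕ) → (Ls : Fin k → FinLattice) → CountIs F N k Ls →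
    ∃ λ d → ∃ λ n₀ → ∀ n → n₀ ≤ n →
    ∃ λ m → Σ (Fin m → FinLattice) λ Ms →
    DistinctMembers F n m Ms × (k ^ n ≤ suc d * m ^ (N ∸ 1))
theorem2 F isoInv closed (C , C∈F , C-size , _) (suc (suc p)) (s≤s (s≤s z≤n)) k Ls ((Ls-members , Ls-distinct) , _) =
  k ^ suc (suc p) , 2 , witnesses
  where
  two : BlockFor F 1 C
  two = asBlock F isoInv C C∈F C-size

  block : ∀ x → BlockFor F (suc p) (Ls x)
  block x = asBlock F isoInv (Ls x) (proj₁ (Ls-members x)) (proj₂ (Ls-members x))

  block-distinct : ∀ x y → OrderIso (le (lattice (proj₁ (block x)))) (le (lattice (proj₁ (block y)))) → x ≡ y
  block-distinct x y I = Ls-distinct x y (toLatticeIso {Ls x} {Ls y}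
    (iso-trans (proj₂ (proj₂ (block x))) (iso-trans I (iso-sym (proj₂ (proj₂ (block y)))))))

  open Stacks F closed (proj₁ two) (proj₁ (proj₂ two)) (proj₁ ∘ block) (proj₁ ∘ proj₂ ∘ block) block-distinct

  witnesses : ∀ n → 2 ≤ n → ∃ λ m → Σ (Fin m → FinLattice) λ Ms →
    DistinctMembers F n m Ms × (k ^ n ≤ suc (k ^ suc (suc p)) * m ^ suc p)
  witnesses (suc (suc n)) (s≤s (s≤s z≤n)) =
      k ^ q , member r q
    , subst (λ n′ → DistinctMembers F (2 + n′) (k ^ q) (member r q)) (sym (division n p)) (members r q)
    , ≤-trans (power-bound k (suc (suc p)) q (suc p) (s≤s (s≤s (quotient-bound n p)))) (m≤n+m _ _)
    where
    q r : ℕ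
    q = n / suc p
    r = n % suc p
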